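{- Let $\lambda$ be a Young diagram with $k$ rows of lengths $\lambda_1\ge\dots\ge\lambda_k>0$, let $T$ be an X-diagram of shape $\lambda$, let $U=\phi(T)$, and let $1\le j\le\lambda_k$. Then the following are equivalent: (i) the pivot column of $T$ exists and is the $j$th column; (ii) $U(k,j)=1$ and $U(k,i)=0$ for all $i<j$.
   Context: Young diagrams are in English notation: rows $1,\dots,k$ from top to bottom, left-justified, cells $(i,j)$ with $1\le j\le\lambda_i$; $T(i,j)$ is the entry in cell $(i,j)$. A diagram is a filling of the cells with 0s and 1s. An X-diagram is a diagram with no rows $i<i'$ and columns $j<j'$ (all four cells in the shape) such that the entries $T(i,j),T(i,j'),T(i',j),T(i',j')$ equal $1,0,0,1$ or $0,1,1,0$. A zero-column/zero-row is a column/row of 0s. The pivot column of a diagram $T$ of shape $\lambda$ is defined as follows: among the columns $j\in\{1,\dots,\lambda_k\}$ with $T(k,j)=1$, consider those having the maximal number of 0s, and take the leftmost of these; it exists iff the bottom row is not a zero-row. The map $\phi$ is defined by: if the bottom row of $T$ is a zero-row, $\phi(T)=T$; otherwise, with $j$ the index of the pivot column, $\phi(T)$ is obtained from $T$ by (1) for each column $i<j$, changing the bottom entry $T(k,i)$ into 0; (2) for each column $i$ with $j<i\le\lambda_k$ identical to column $j$, replacing it by the column with a 1 in the bottom cell and 0s elsewhere; (3) for each column $i$ with $j<i\le\lambda_k$ that is not identical to column $j$ and is not a zero-column, changing the bottom entry into 1; all other entries are unchanged. -}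

module Defs where

open import Data.Nat using (ℕ; zero; suc; _≤_; _<_; _≡ᵇ_; _<ᵇ_; _≤ᵇ_; _⊔_)
open import Data.Bool using (Bool; true; false; not; _∧_; _∨_; if_then_else_)
open import Data.List using (List; []; _∷_; map; filter; length; upTo; foldr)
open import Data.Maybe using (Maybe; just; nothing)
open import Data.Product using (_×_)
open import Relation.Binary.PropositionalEquality using (_≡_)
open import Relation.Nullary using (¬_)
open import Relation.Nullary.Decidable using (does)
open import Data.Bool.Properties using (T?)
open import Data.Bool using (T)

-- Conventions: rows and columns are 1-based natural numbers.
-- A shape is given by k (number of rows) and lam : ℕ → ℕ, where lam i is the
-- length of row i for 1 ≤ i ≤ k (values of lam outside 1..k are irrelevant).
-- A diagram is a 0/1 filling, represented as a function ℕ → ℕ → Bool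
-- (true = 1, false = 0); only entries at cells of the shape are meaningful.

Diagram : Set
Diagram = ℕ → ℕ → Bool

IsShape : ℕ → (ℕ → ℕ) → Set
IsShape k lam = (1 ≤ k) × ((∀ i → 1 ≤ i → i < k → lam (suc i) ≤ lam i) × (0 < lam k))

InShape : ℕ → (ℕ → ℕ) → ℕ → ℕ → Set
InShape k lam i j = (1 ≤ i) × ((i ≤ k) × ((1 ≤ j) × (j ≤ lam i)))

IsXDiagram : ℕ → (ℕ → ℕ) → Diagram → Set
IsXDiagram k lam t =
  ∀ i i' j j' → i < i' → j < j' →
  InShape k lam i j → InShape k lam i j' → InShape k lam i' j → InShape k lam i' j' →
  ¬ ((t i j ≡ true) × (t i j' ≡ false) × (t i' j ≡ false) × (t i' j' ≡ true))
  × ¬ ((t i j ≡ false) × (t i j' ≡ true) × (t i' j ≡ true) × (t i' j' ≡ false))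

allᵇ : (ℕ → Bool) → List ℕ → Bool
allᵇ p [] = true
allᵇ p (x ∷ xs) = p x ∧ allᵇ p xs

range1 : ℕ → List ℕ
range1 n = map suc (upTo n)

-- For a column j with j ≤ lam k, the column consists of rows 1..k.
-- number of 0s in column j (j ≤ lam k)
zerosInCol : ℕ → Diagram → ℕ → ℕ
zerosInCol k t j = length (filter (λ i → T? (not (t i j))) (range1 k))

zeroColᵇ : ℕ → Diagram → ℕ → Bool
zeroColᵇ k t j = allᵇ (λ i → not (t i j)) (range1 k)

sameColᵇ : ℕ → Diagram → ℕ → ℕ → Bool
sameColᵇ k t j j' = allᵇ (λ i → t i j ∧ t i j' ∨ not (t i j) ∧ not (t i j')) (range1 k)

firstSuch : (ℕ → Bool) → List ℕ → Maybe ℕ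
firstSuch p [] = nothing
firstSuch p (x ∷ xs) = if p x then just x else firstSuch p xs

pivot : ℕ → (ℕ → ℕ) → Diagram → Maybe ℕ
pivot k lam t =
  let cands = filter (λ j → T? (t k j)) (range1 (lam k))
      m     = foldr (λ j acc → zerosInCol k t j ⊔ acc) 0 cands
  in firstSuch (λ j → zerosInCol k t j ≡ᵇ m) cands

phiWith : ℕ → (ℕ → ℕ) → Diagram → ℕ → Diagram
phiWith k lam t p i c =
  if (i ≡ᵇ k) ∧ (1 ≤ᵇ c) ∧ (c <ᵇ p) then false
  else if (p <ᵇ c) ∧ (c ≤ᵇ lam k) then
    (if sameColᵇ k t c p then (i ≡ᵇ k)
     else if not (zeroColᵇ k t c) ∧ (i ≡ᵇ k) then true
     else t i c)
  else t i c

phi : ℕ → (ℕ → ℕ) → Diagram → Diagram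
phi k lam t with pivot k lam t
... | nothing = t
... | just p  = phiWith k lam t p

module Submission where

-- If the pivot is p, then step (1) of φ clears the bottom row left
-- of p while the entry at the pivot, which is 1 by definition, is left
-- unchanged; so p is the leftmost 1 in the bottom row of U.  Conversely,
-- if U has a 1 at (k,j) the pivot must exist (otherwise U = T and T has a
-- bottom 1 at column j), and the leftmost 1 of a row is unique, so the
-- pivot is j.

open import Defs
open import Data.Nat using (ℕ; zero; suc; _≤_; _<_; _⊔_; _≡ᵇ_; _<ᵇ_; s≤s; z≤n)
open import Data.Nat.Properties
  using (⊔-sel; ⊔-identityʳ; <-cmp; ≡⇒≡ᵇ; <⇒<ᵇ)
open import Data.Bool using (Bool; true; false; T)
open import Data.Bool.Properties using (T?; T-≡)
open import Data.Maybe using (just; nothing)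
open import Data.Maybe.Properties using (just-injective)
open import Data.Product using (_×_; _,_; ∃)
open import Data.Sum using (inj₁; inj₂)
open import Data.List using (List; []; _∷_; filter; foldr)
open import Data.List.Membership.Propositional using (_∈_)
open import Data.List.Relation.Unary.Any using (here; there)
open import Data.List.Membership.Propositional.Properties
  using (∈-map⁺; ∈-map⁻; ∈-upTo⁺; ∈-upTo⁻; ∈-filter⁺; ∈-filter⁻)
open import Function.Bundles using (_⇔_; mk⇔; Equivalence)
open import Relation.Binary.PropositionalEquality
open import Relation.Binary.Definitions using (tri<; tri≈; tri>)
open import Relation.Nullary using (¬_)

T⇒≡true : ∀ {b} → T b → b ≡ true
T⇒≡true = Equivalence.to T-≡

≡ᵇ-refl : ∀ n → (n ≡ᵇ n) ≡ true
≡ᵇ-refl n = T⇒≡true (≡⇒≡ᵇ n n refl)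

<ᵇ-irrefl : ∀ n → (n <ᵇ n) ≡ false
<ᵇ-irrefl zero    = refl
<ᵇ-irrefl (suc n) = <ᵇ-irrefl n

firstSuch-∈ : ∀ (p : ℕ → Bool) xs {x} → firstSuch p xs ≡ just x → x ∈ xs
firstSuch-∈ p (y ∷ xs) eq with p y
... | true  = here (sym (just-injective eq))
... | false = there (firstSuch-∈ p xs eq)

firstSuch-nothing : ∀ (p : ℕ → Bool) xs {x} →
  firstSuch p xs ≡ nothing → x ∈ xs → p x ≡ false
firstSuch-nothing p (y ∷ xs) eq (here refl) with p y
... | false = refl
firstSuch-nothing p (y ∷ xs) eq (there x∈xs) with p y
... | false = firstSuch-nothing p xs eq x∈xs

maxOf : (ℕ → ℕ) → List ℕ → ℕ
maxOf f = foldr (λ j acc → f j ⊔ acc) 0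

maxOf-attained : ∀ f y xs → ∃ λ x → x ∈ y ∷ xs × f x ≡ maxOf f (y ∷ xs)
maxOf-attained f y [] = y , here refl , sym (⊔-identityʳ (f y))
maxOf-attained f y (z ∷ xs) with ⊔-sel (f y) (maxOf f (z ∷ xs))
... | inj₁ fy-is-max = y , here refl , sym fy-is-max
... | inj₂ rest-is-max with maxOf-attained f z xs
...   | x , x∈ , fx = x , there x∈ , trans fx (sym rest-is-max)

∈-range1⁻ : ∀ {n x} → x ∈ range1 n → 1 ≤ x × x ≤ n
∈-range1⁻ x∈ with ∈-map⁻ suc x∈
... | _ , y∈ , refl = s≤s z≤n , ∈-upTo⁻ y∈

∈-range1⁺ : ∀ {n x} → 1 ≤ x → x ≤ n → x ∈ range1 n
∈-range1⁺ {suc n} (s≤s z≤n) (s≤s x≤n) = ∈-map⁺ suc (∈-upTo⁺ (s≤s x≤n))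

pivot-column : ∀ k lam t {p} → pivot k lam t ≡ just p →
  1 ≤ p × t k p ≡ true
pivot-column k lam t eq
  with ∈-filter⁻ (λ j → T? (t k j)) (firstSuch-∈ _ _ eq)
... | p∈ , tkp with ∈-range1⁻ {lam k} p∈
...   | 1≤p , _ = 1≤p , T⇒≡true tkp

-- If the bottom row is not a zero-row then the pivot exists: the list of
-- candidates is nonempty, so the maximal number of 0s is attained by one of
-- them, and 'firstSuch' cannot fail.
pivot-exists : ∀ k lam t {j} → 1 ≤ j → j ≤ lam k → t k j ≡ true →
  ¬ pivot k lam t ≡ nothing
pivot-exists k lam t 1≤j j≤lam tkj eq
  with filter (λ j → T? (t k j)) (range1 (lam k))
     | ∈-filter⁺ (λ j → T? (t k j)) (∈-range1⁺ 1≤j j≤lam) (subst T (sym tkj) _)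
... | y ∷ ys | _ with maxOf-attained (zerosInCol k t) y ys
...   | x , x∈ , x-max with firstSuch-nothing _ (y ∷ ys) eq x∈
...     | not-max rewrite T⇒≡true (≡⇒≡ᵇ _ _ x-max) with () ← not-max

phiWith-left : ∀ k lam t p c → 1 ≤ c → c < p → phiWith k lam t p k c ≡ false
phiWith-left k lam t p (suc c) (s≤s z≤n) c<p
  rewrite ≡ᵇ-refl k | T⇒≡true (<⇒<ᵇ c<p) = refl

phiWith-pivot : ∀ k lam t p → 1 ≤ p → phiWith k lam t p k p ≡ t k p
phiWith-pivot k lam t (suc p) (s≤s z≤n) rewrite ≡ᵇ-refl k | <ᵇ-irrefl p = refl

IsLeftmostOne : (ℕ → Bool) → ℕ → Set
IsLeftmostOne f j = (f j ≡ true) × (∀ i → 1 ≤ i → i < j → f i ≡ false)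

leftmostOne-unique : ∀ f {j p} → 1 ≤ j → 1 ≤ p →
  IsLeftmostOne f j → IsLeftmostOne f p → j ≡ p
leftmostOne-unique f {j} {p} 1≤j 1≤p (fj , left-j) (fp , left-p) with <-cmp j p
... | tri≈ _ j≡p _ = j≡p
... | tri< j<p _ _ with () ← trans (sym fj) (left-p j 1≤j j<p)
... | tri> _ _ p<j with () ← trans (sym fp) (left-j p 1≤p p<j)

phiWith-leftmostOne : ∀ k lam t p → 1 ≤ p → t k p ≡ true →
  IsLeftmostOne (phiWith k lam t p k) p
phiWith-leftmostOne k lam t p 1≤p tkp =
  trans (phiWith-pivot k lam t p 1≤p) tkp , λ i 1≤i i<p → phiWith-left k lam t p i 1≤i i<p

lemma3p4 : (k : ℕ) (lam : ℕ → ℕ) → IsShape k lam →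
    (t : Diagram) → IsXDiagram k lam t →
    (j : ℕ) → 1 ≤ j → j ≤ lam k →
    (pivot k lam t ≡ just j)
      ⇔ ((phi k lam t k j ≡ true) × (∀ i → 1 ≤ i → i < j → phi k lam t k i ≡ false))
lemma3p4 k lam _ t _ j 1≤j j≤lam = mk⇔ pivot⇒leftmostOne leftmostOne⇒pivot
  where
  pivot⇒leftmostOne : pivot k lam t ≡ just j → IsLeftmostOne (phi k lam t k) j
  pivot⇒leftmostOne eq with pivot-column k lam t eq
  ... | _ , tkj rewrite eq = phiWith-leftmostOne k lam t j 1≤j tkj

  leftmostOne⇒pivot : IsLeftmostOne (phi k lam t k) j → pivot k lam t ≡ just j
  leftmostOne⇒pivot (ukj , left-j) with pivot k lam t in eq
  -- without a pivot φ(T) = T, whose bottom row would then contain a 1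
  ... | nothing with () ← pivot-exists k lam t 1≤j j≤lam ukj eq
  ... | just p with pivot-column k lam t eq
  ...   | 1≤p , tkp = cong just
    (leftmostOne-unique (phiWith k lam t p k) 1≤p 1≤j
       (phiWith-leftmostOne k lam t p 1≤p tkp) (ukj , left-j))
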